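{- Let $\mathcal A=\{p_1,\dots,p_n\}\subset\mathbb R^2$ and let $\lambda_1,\dots,\lambda_n$ be an affine dependence, i.e. $\sum_i\lambda_ip_i=0$ and $\sum_i\lambda_i=0$. Let $G$ be the complete graph on $\mathcal A$ with edge set $E$, with all vertices marked. Then setting $w_{ij}=\lambda_i\lambda_j$ for every edge $ij$ and $\alpha_i=\sum_{j:ij\in E}\lambda_i\lambda_j|p_i-p_j|$ for every $i$ defines a stress of $G$.
   Context: Let $G$ be a graph on $\mathcal A$ with edge set $E$ and set $V$ of marked vertices. A stress on $G$ is an assignment of scalars $w_{ij}$ to edges and $\alpha_i$ to marked vertices such that, for every $(v,t)\in(\mathbb R^2)^n\times\mathbb R^n$, $$\sum_{ij\in E}w_{ij}\big(\langle p_i-p_j,v_i-v_j\rangle-|p_i-p_j|(t_i+t_j)\big)+\sum_{i\in V}\alpha_it_i=0.$$ -}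

module Defs where

open import Level using (Level; _⊔_) renaming (suc to lsuc)
open import Algebra.Bundles using (CommutativeRing)
open import Relation.Binary.Structures using (IsTotalOrder)
open import Relation.Nullary using (¬_; yes; no; ¬?)
open import Data.Product using (Σ; ∃; _×_; _,_; proj₁; proj₂)
open import Data.Fin using (Fin; _<?_; _≟_)
open import Data.List using (List; []; _∷_; foldr; map; filter; concatMap; allFin)

-- An axiomatisation of the real numbers: a complete ordered field
-- (equipped with a square-root operation on non-negative elements).
-- Any model is (isomorphic to) ℝ.
record RealField (c ℓ : Level) : Set (lsuc (c ⊔ ℓ)) where
  field
    commRing : CommutativeRing c ℓ
  open CommutativeRing commRing public
  field
    _≤_ : Carrier → Carrier → Set ℓ
    isTotalOrder : IsTotalOrder _≈_ _≤_
    +-mono-≤ : ∀ {x y} z → x ≤ y → (x + z) ≤ (y + z)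
    *-nonneg : ∀ {x y} → 0# ≤ x → 0# ≤ y → 0# ≤ (x * y)
    0≉1 : ¬ (0# ≈ 1#)
    inverse : ∀ x → ¬ (x ≈ 0#) → Σ Carrier (λ y → (x * y) ≈ 1#)
    lub : (S : Carrier → Set (c ⊔ ℓ)) → Σ Carrier S →
          Σ Carrier (λ b → ∀ x → S x → x ≤ b) →
          Σ Carrier (λ s → (∀ x → S x → x ≤ s) ×
                           (∀ b → (∀ x → S x → x ≤ b) → s ≤ b))
    sqrt : Carrier → Carrier
    sqrt-nonneg : ∀ {x} → 0# ≤ x → 0# ≤ sqrt x
    sqrt-sq : ∀ {x} → 0# ≤ x → (sqrt x * sqrt x) ≈ x

module Plane {c ℓ : Level} (R : RealField c ℓ) where
  open RealField R

  ℝ² : Set c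
  ℝ² = Carrier × Carrier

  _-ᵥ_ : ℝ² → ℝ² → ℝ²
  (a , b) -ᵥ (a' , b') = (a - a') , (b - b')

  ⟨_,_⟩ : ℝ² → ℝ² → Carrier
  ⟨ (a , b) , (a' , b') ⟩ = (a * a') + (b * b')

  ∣_∣ : ℝ² → Carrier
  ∣ (a , b) ∣ = sqrt ((a * a) + (b * b))

  Σ[_]_ : {A : Set} → List A → (A → Carrier) → Carrier
  Σ[ xs ] f = foldr (λ x acc → f x + acc) 0# xs

  Σᵥ : {n : _} → List (Fin n) → (Fin n → ℝ²) → ℝ²
  Σᵥ xs f = (Σ[ xs ] (λ i → proj₁ (f i))) , (Σ[ xs ] (λ i → proj₂ (f i)))

  _≈₂_ : ℝ² → ℝ² → Set ℓ
  (a , b) ≈₂ (a' , b') = (a ≈ a') × (b ≈ b')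

  _·ᵥ_ : Carrier → ℝ² → ℝ²
  s ·ᵥ (a , b) = (s * a) , (s * b)

  -- A graph on vertex set Fin n: edge list (each edge ij listed once,
  -- as an ordered pair) and a list of marked vertices.
  record Graph (n : _) : Set where
    field
      E : List (Fin n × Fin n)
      V : List (Fin n)

  completeGraph : ∀ n → Graph n
  completeGraph n = record
    { E = concatMap (λ i → map (λ j → (i , j)) (filter (λ j → i <? j) (allFin n))) (allFin n)
    ; V = allFin n }

  IsStress : ∀ {n} → (p : Fin n → ℝ²) → Graph n →
             (w : Fin n → Fin n → Carrier) → (α : Fin n → Carrier) → Set (c ⊔ ℓ)
  IsStress {n} p G w α =
    ∀ (v : Fin n → ℝ²) (t : Fin n → Carrier) →
      ((Σ[ Graph.E G ] (λ { (i , j) →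
           w i j * (⟨ p i -ᵥ p j , v i -ᵥ v j ⟩ - (∣ p i -ᵥ p j ∣ * (t i + t j))) }))
       + (Σ[ Graph.V G ] (λ i → α i * t i))) ≈ 0#

  neighboursK : ∀ n → Fin n → List (Fin n)
  neighboursK n i = filter (λ j → ¬? (i ≟ j)) (allFin n)

{-# OPTIONS --safe #-}
-- Split each edge term λᵢλⱼ(⟨pᵢ - pⱼ, vᵢ - vⱼ⟩ - |pᵢ - pⱼ|(tᵢ + tⱼ)) into two half-edge
-- terms λᵢλⱼ(⟨pᵢ, vᵢ - vⱼ⟩ - |pᵢ - pⱼ| tᵢ), one at each endpoint.  In the complete graph the
-- half-edges at i run over all j ≠ i, so their t-parts add up to exactly -αᵢ tᵢ and cancel the
-- vertex terms.  What is left is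
--   Σᵢⱼ λᵢλⱼ⟨pᵢ, vᵢ - vⱼ⟩ = (Σⱼ λⱼ)(Σᵢ λᵢ⟨pᵢ, vᵢ⟩) - ⟨Σᵢ λᵢpᵢ, Σⱼ λⱼvⱼ⟩,
-- which vanishes by the affine dependence.  The symmetry |pᵢ - pⱼ| = |pⱼ - pᵢ| is not free:
-- sqrt is not assumed to respect ≈, so it comes from uniqueness of non-negative square roots.
module Submission where

open import Defs
open import Level using (Level; 0ℓ; _⊔_; Lift; lift)
open import Algebra.Bundles using (CommutativeRing; RawRing; Ring)
open import Algebra.Solver.Ring.AlmostCommutativeRing
  using (fromCommutativeRing; _-Raw-AlmostCommutative⟶_)
open import Data.Bool using (if_then_else_)
open import Data.Empty using (⊥-elim)
open import Data.Fin using (Fin; _<?_; _≟_)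
open import Data.Fin.Properties using (<-cmp)
open import Data.List using (List; []; _∷_; _++_; map; filter; concatMap; allFin)
open import Data.List.Properties using (foldr-map)
open import Data.Maybe using (Maybe; just; nothing)
open import Data.Nat as ℕ using (ℕ; zero; suc)
open import Data.Product using (_×_; _,_; proj₁; proj₂)
open import Data.Product.Properties using (≡-dec)
open import Data.Sum using (inj₁; inj₂)
open import Relation.Binary.Definitions using (tri<; tri≈; tri>)
open import Relation.Binary.PropositionalEquality as ≡ using (_≡_)
open import Relation.Binary.Structures using (IsTotalOrder)
open import Relation.Nullary using (Dec; does; yes; no; ¬?)
open import Relation.Nullary.Decidable using (dec-true; dec-false)
open import Relation.Unary using (Decidable)

module IntegerCoefficientRingSolver {c ℓ : Level} (CR : CommutativeRing c ℓ) where
  open CommutativeRing CR hiding (zero)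
  open import Algebra.Properties.Semiring.Mult semiring using (×-homo-+; ×1-homo-*) renaming (_×_ to _·1_)
  open import Algebra.Properties.AbelianGroup +-abelianGroup using (⁻¹-anti-homo‿-; ⁻¹-∙-comm)
  open import Algebra.Properties.Group +-group using (ε⁻¹≈ε)
  open import Algebra.Properties.CommutativeSemigroup +-commutativeSemigroup using (interchange)
  open import Algebra.Properties.RingWithoutOne (Ring.ringWithoutOne ring) using (x[y-z]≈xy-xz; [y-z]x≈yx-zx)
  open import Relation.Binary.Reasoning.Setoid setoid

  private
    +-minus-interchange : ∀ w x y z → (w + y) - (x + z) ≈ (w - x) + (y - z)
    +-minus-interchange w x y z = begin
      (w + y) - (x + z)     ≈⟨ +-congˡ (⁻¹-∙-comm x z) ⟨
      (w + y) + (- x + - z) ≈⟨ interchange w y (- x) (- z) ⟩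
      (w - x) + (y - z)     ∎

    minus-minus : ∀ w x y z → (w - x) - (y - z) ≈ (w + z) - (x + y)
    minus-minus w x y z = begin
      (w - x) - (y - z) ≈⟨ +-congˡ (⁻¹-anti-homo‿- y z) ⟩
      (w - x) + (z - y) ≈⟨ +-minus-interchange w x z y ⟨
      (w + z) - (x + y) ∎

  -- Coefficients for the ring solver: over the carrier itself x - x would not normalise
  -- to 0.  (a , b) stands for a - b and is kept with one side zero, so that normal forms
  -- compare by refl.
  normalise : ℕ × ℕ → ℕ × ℕ
  normalise (zero , b)      = zero , b
  normalise (suc a , zero)  = suc a , zero
  normalise (suc a , suc b) = normalise (a , b)

  ℤ-pairs : RawRing 0ℓ 0ℓ
  ℤ-pairs = record
    { Carrier = ℕ × ℕ
    ; _≈_     = _≡_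
    ; _+_     = λ { (a , b) (c , d) → normalise (a ℕ.+ c , b ℕ.+ d) }
    ; _*_     = λ { (a , b) (c , d) → normalise (a ℕ.* c ℕ.+ b ℕ.* d , a ℕ.* d ℕ.+ b ℕ.* c) }
    ; -_      = λ { (a , b) → b , a }
    ; 0#      = 0 , 0
    ; 1#      = 1 , 0
    }

  ⟦_⟧ : ℕ × ℕ → Carrier
  ⟦ a , b ⟧ = a ·1 1# - b ·1 1#

  ⟦normalise⟧ : ∀ q → ⟦ normalise q ⟧ ≈ ⟦ q ⟧
  ⟦normalise⟧ (zero , b)      = refl
  ⟦normalise⟧ (suc a , zero)  = refl
  ⟦normalise⟧ (suc a , suc b) = begin
    ⟦ normalise (a , b) ⟧            ≈⟨ ⟦normalise⟧ (a , b) ⟩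
    ⟦ a , b ⟧                        ≈⟨ +-identityˡ _ ⟨
    0# + ⟦ a , b ⟧                   ≈⟨ +-congʳ (-‿inverseʳ 1#) ⟨
    (1# - 1#) + ⟦ a , b ⟧            ≈⟨ +-minus-interchange 1# 1# (a ·1 1#) (b ·1 1#) ⟨
    ⟦ suc a , suc b ⟧                ∎

  ⟦⟧-homo-+ : ∀ a b c d → ⟦ normalise (a ℕ.+ c , b ℕ.+ d) ⟧ ≈ ⟦ a , b ⟧ + ⟦ c , d ⟧
  ⟦⟧-homo-+ a b c d = begin
    ⟦ normalise (a ℕ.+ c , b ℕ.+ d) ⟧         ≈⟨ ⟦normalise⟧ (a ℕ.+ c , b ℕ.+ d) ⟩
    (a ℕ.+ c) ·1 1# - (b ℕ.+ d) ·1 1#         ≈⟨ +-cong (×-homo-+ 1# a c) (-‿cong (×-homo-+ 1# b d)) ⟩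
    (a ·1 1# + c ·1 1#) - (b ·1 1# + d ·1 1#) ≈⟨ +-minus-interchange _ _ _ _ ⟩
    ⟦ a , b ⟧ + ⟦ c , d ⟧                     ∎

  ⟦⟧-homo-* : ∀ a b c d →
    ⟦ normalise (a ℕ.* c ℕ.+ b ℕ.* d , a ℕ.* d ℕ.+ b ℕ.* c) ⟧ ≈ ⟦ a , b ⟧ * ⟦ c , d ⟧
  ⟦⟧-homo-* a b c d = begin
    ⟦ normalise (a ℕ.* c ℕ.+ b ℕ.* d , a ℕ.* d ℕ.+ b ℕ.* c) ⟧
      ≈⟨ ⟦normalise⟧ (a ℕ.* c ℕ.+ b ℕ.* d , a ℕ.* d ℕ.+ b ℕ.* c) ⟩
    ⟦ a ℕ.* c ℕ.+ b ℕ.* d , a ℕ.* d ℕ.+ b ℕ.* c ⟧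
      ≈⟨ +-cong (·1-homo a c b d) (-‿cong (·1-homo a d b c)) ⟩
    (A * C + B * D) - (A * D + B * C)
      ≈⟨ minus-minus (A * C) (A * D) (B * C) (B * D) ⟨
    (A * C - A * D) - (B * C - B * D)
      ≈⟨ +-cong (x[y-z]≈xy-xz A C D) (-‿cong (x[y-z]≈xy-xz B C D)) ⟨
    A * (C - D) - B * (C - D)
      ≈⟨ [y-z]x≈yx-zx (C - D) A B ⟨
    ⟦ a , b ⟧ * ⟦ c , d ⟧ ∎
    where
    A B C D : Carrier
    A = a ·1 1#
    B = b ·1 1#
    C = c ·1 1#
    D = d ·1 1#
    ·1-homo : ∀ a c b d → (a ℕ.* c ℕ.+ b ℕ.* d) ·1 1# ≈ a ·1 1# * c ·1 1# + b ·1 1# * d ·1 1#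
    ·1-homo a c b d = trans (×-homo-+ 1# (a ℕ.* c) (b ℕ.* d)) (+-cong (×1-homo-* a c) (×1-homo-* b d))

  ℤ-pairs⟶CR : ℤ-pairs -Raw-AlmostCommutative⟶ fromCommutativeRing CR
  ℤ-pairs⟶CR = record
    { ⟦_⟧    = ⟦_⟧
    ; +-homo = λ { (a , b) (c , d) → ⟦⟧-homo-+ a b c d }
    ; *-homo = λ { (a , b) (c , d) → ⟦⟧-homo-* a b c d }
    ; -‿homo = λ { (a , b) → sym (⁻¹-anti-homo‿- (a ·1 1#) (b ·1 1#)) }
    ; 0-homo = -‿inverseʳ 0#
    ; 1-homo = trans (+-congˡ ε⁻¹≈ε) (trans (+-identityʳ _) (+-identityʳ 1#))
    }

  _≟ℤ_ : ∀ x y → Maybe (⟦ x ⟧ ≈ ⟦ y ⟧)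
  x ≟ℤ y with ≡-dec ℕ._≟_ ℕ._≟_ x y
  ... | yes ≡.refl = just refl
  ... | no _     = nothing

  open import Algebra.Solver.Ring ℤ-pairs (fromCommutativeRing CR) ℤ-pairs⟶CR _≟ℤ_ public
    using (solve; _:=_; _:+_; _:*_; _:-_; :-_)

module SquareRoot {c ℓ : Level} (R : RealField c ℓ) where
  open RealField R hiding (zero)
  open IntegerCoefficientRingSolver commRing
  module ≤ = IsTotalOrder isTotalOrder

  ≤-resp-≈ : ∀ {x y x′ y′} → x ≈ x′ → y ≈ y′ → x ≤ y → x′ ≤ y′
  ≤-resp-≈ x≈x′ y≈y′ x≤y = ≤.trans (≤.reflexive (sym x≈x′)) (≤.trans x≤y (≤.reflexive y≈y′))

  x≤y⇒0≤y-x : ∀ {x y} → x ≤ y → 0# ≤ (y - x)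
  x≤y⇒0≤y-x {x} x≤y = ≤-resp-≈ (-‿inverseʳ x) refl (+-mono-≤ (- x) x≤y)

  0≤-x⇒x≤0 : ∀ {x} → 0# ≤ (- x) → x ≤ 0#
  0≤-x⇒x≤0 {x} 0≤-x = ≤-resp-≈ (+-identityˡ x) (-‿inverseˡ x) (+-mono-≤ x 0≤-x)

  x≤0⇒0≤-x : ∀ {x} → x ≤ 0# → 0# ≤ (- x)
  x≤0⇒0≤-x {x} x≤0 = ≤-resp-≈ refl (+-identityˡ (- x)) (x≤y⇒0≤y-x x≤0)

  0≤y⇒x≤x+y : ∀ x {y} → 0# ≤ y → x ≤ (x + y)
  0≤y⇒x≤x+y x {y} 0≤y = ≤-resp-≈ (+-identityˡ x) (+-comm y x) (+-mono-≤ x 0≤y)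

  +-nonneg : ∀ {x y} → 0# ≤ x → 0# ≤ y → 0# ≤ (x + y)
  +-nonneg {x} 0≤x 0≤y = ≤.trans 0≤x (0≤y⇒x≤x+y x 0≤y)

  +-nonpos : ∀ {x y} → x ≤ 0# → y ≤ 0# → (x + y) ≤ 0#
  +-nonpos {x} {y} x≤0 y≤0 = ≤.trans (+-mono-≤ y x≤0) (≤-resp-≈ (sym (+-identityˡ y)) refl y≤0)

  *-monoˡ-≤-nonneg : ∀ {z x y} → 0# ≤ z → x ≤ y → (x * z) ≤ (y * z)
  *-monoˡ-≤-nonneg {z} {x} {y} 0≤z x≤y = ≤-resp-≈ refl
    (solve 3 (λ z x y → x :* z :+ (y :- x) :* z := y :* z) refl z x y)
    (0≤y⇒x≤x+y (x * z) (*-nonneg (x≤y⇒0≤y-x x≤y) 0≤z))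

  0≤x*x : ∀ x → 0# ≤ (x * x)
  0≤x*x x with ≤.total 0# x
  ... | inj₁ 0≤x = *-nonneg 0≤x 0≤x
  ... | inj₂ x≤0 = ≤-resp-≈ refl (solve 1 (λ x → :- x :* :- x := x :* x) refl x)
                     (*-nonneg (x≤0⇒0≤-x x≤0) (x≤0⇒0≤-x x≤0))

  0≤1 : 0# ≤ 1#
  0≤1 = ≤-resp-≈ refl (*-identityˡ 1#) (0≤x*x 1#)

  x*x≤0⇒x≈0 : ∀ {d} → 0# ≤ d → (d * d) ≤ 0# → d ≈ 0#
  x*x≤0⇒x≈0 {d} 0≤d dd≤0 = ≤.antisym d≤0 0≤d
    where
    -- The inverse axiom would only refute d ≉ 0.  Instead, Null is closed under d + _,
    -- so its supremum s satisfies s ≤ s - d, i.e. d ≤ 0.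
    Null : Carrier → Set (c ⊔ ℓ)
    Null x = Lift c (0# ≤ x × (x * x) ≤ 0#)

    bounded : ∀ x → Null x → x ≤ 1#
    bounded x (lift (0≤x , xx≤0)) with ≤.total x 1#
    ... | inj₁ x≤1 = x≤1
    ... | inj₂ 1≤x = ⊥-elim (0≉1 (≤.antisym 0≤1 1≤0))
      where
      1≤0 : 1# ≤ 0#
      1≤0 = ≤.trans 1≤x (≤.trans (≤-resp-≈ (*-identityˡ x) refl (*-monoˡ-≤-nonneg 0≤x 1≤x)) xx≤0)

    dx≤0 : ∀ {x} → Null x → (d * x) ≤ 0#
    dx≤0 {x} (lift (0≤x , xx≤0)) with ≤.total d x
    ... | inj₁ d≤x = ≤.trans (*-monoˡ-≤-nonneg 0≤x d≤x) xx≤0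
    ... | inj₂ x≤d = ≤-resp-≈ (*-comm x d) refl (≤.trans (*-monoˡ-≤-nonneg 0≤d x≤d) dd≤0)

    d+-closed : ∀ x → Null x → Null (d + x)
    d+-closed x Nx@(lift (0≤x , xx≤0)) = lift (+-nonneg 0≤d 0≤x ,
      ≤-resp-≈ (solve 2 (λ d x → d :* d :+ (x :* x :+ (d :* x :+ d :* x)) := (d :+ x) :* (d :+ x)) refl d x) refl
        (+-nonpos dd≤0 (+-nonpos xx≤0 (+-nonpos (dx≤0 Nx) (dx≤0 Nx)))))

    s : Carrier
    s = proj₁ (lub Null (0# , lift (≤.refl , ≤-resp-≈ refl (zeroˡ 0#) ≤.refl)) (1# , bounded))

    s-upper : ∀ x → Null x → x ≤ s
    s-upper = proj₁ (proj₂ (lub Null _ _))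

    s-least : ∀ b → (∀ x → Null x → x ≤ b) → s ≤ b
    s-least = proj₂ (proj₂ (lub Null _ _))

    below-s-d : ∀ x → Null x → x ≤ (s - d)
    below-s-d x Nx = ≤-resp-≈ (solve 2 (λ d x → (d :+ x) :- d := x) refl d x) refl
      (+-mono-≤ (- d) (s-upper (d + x) (d+-closed x Nx)))

    d≤0 : d ≤ 0#
    d≤0 = 0≤-x⇒x≤0 (≤-resp-≈ refl (solve 2 (λ s d → (s :- d) :- s := :- d) refl s d)
      (x≤y⇒0≤y-x (s-least (s - d) below-s-d)))

  ≤-square-cancel : ∀ {x y} → 0# ≤ x → x ≤ y → (y * y) ≈ (x * x) → y ≈ x
  ≤-square-cancel {x} {y} 0≤x x≤y yy≈xx = begin
    y       ≈⟨ solve 2 (λ x y → y := x :+ (y :- x)) refl x y ⟩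
    x + δ   ≈⟨ +-congˡ δ≈0 ⟩
    x + 0#  ≈⟨ +-identityʳ x ⟩
    x       ∎
    where
    open import Relation.Binary.Reasoning.Setoid setoid
    δ : Carrier
    δ = y - x
    0≤δ : 0# ≤ δ
    0≤δ = x≤y⇒0≤y-x x≤y
    δδ+2xδ≈0 : δ * δ + (x * δ + x * δ) ≈ 0#
    δδ+2xδ≈0 = trans
      (solve 2 (λ x y → (y :- x) :* (y :- x) :+ (x :* (y :- x) :+ x :* (y :- x)) := y :* y :- x :* x) refl x y)
      (trans (+-congʳ yy≈xx) (-‿inverseʳ (x * x)))
    δ≈0 : δ ≈ 0#
    δ≈0 = x*x≤0⇒x≈0 0≤δ (≤-resp-≈ refl δδ+2xδ≈0
      (0≤y⇒x≤x+y (δ * δ) (+-nonneg (*-nonneg 0≤x 0≤δ) (*-nonneg 0≤x 0≤δ))))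

  nonneg-square-injective : ∀ {a b} → 0# ≤ a → 0# ≤ b → (a * a) ≈ (b * b) → a ≈ b
  nonneg-square-injective {a} {b} 0≤a 0≤b aa≈bb with ≤.total a b
  ... | inj₁ a≤b = sym (≤-square-cancel 0≤a a≤b (sym aa≈bb))
  ... | inj₂ b≤a = ≤-square-cancel 0≤b b≤a aa≈bb

  sqrt-cong : ∀ {x y} → 0# ≤ x → x ≈ y → sqrt x ≈ sqrt y
  sqrt-cong {x} {y} 0≤x x≈y = nonneg-square-injective (sqrt-nonneg 0≤x) (sqrt-nonneg 0≤y)
    (trans (sqrt-sq 0≤x) (trans x≈y (sym (sqrt-sq 0≤y))))
    where
    0≤y : 0# ≤ y
    0≤y = ≤-resp-≈ refl x≈y 0≤x

module ListSums {c ℓ : Level} (R : RealField c ℓ) where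
  open RealField R hiding (zero)
  open Plane R
  open IntegerCoefficientRingSolver commRing
  open import Relation.Binary.Reasoning.Setoid setoid

  _when_ : {P : Set} → Carrier → Dec P → Carrier
  x when P? = if does P? then x else 0#

  when-+ : {P : Set} (P? : Dec P) (x y : Carrier) → (x + y) when P? ≈ x when P? + y when P?
  when-+ (yes _) x y = refl
  when-+ (no _)  x y = sym (+-identityˡ 0#)

  when-cong : {P : Set} (P? : Dec P) {x y : Carrier} → x ≈ y → x when P? ≈ y when P?
  when-cong (yes _) x≈y = x≈y
  when-cong (no _)  x≈y = refl

  module _ {A : Set} where

    Σ-cong : (xs : List A) {f g : A → Carrier} → (∀ x → f x ≈ g x) → Σ[ xs ] f ≈ Σ[ xs ] g
    Σ-cong []       f≈g = refl
    Σ-cong (x ∷ xs) f≈g = +-cong (f≈g x) (Σ-cong xs f≈g)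

    Σ-0 : (xs : List A) → Σ[ xs ] (λ _ → 0#) ≈ 0#
    Σ-0 []       = refl
    Σ-0 (x ∷ xs) = trans (+-identityˡ _) (Σ-0 xs)

    Σ-+ : (xs : List A) (f g : A → Carrier) → Σ[ xs ] (λ x → f x + g x) ≈ Σ[ xs ] f + Σ[ xs ] g
    Σ-+ []       f g = sym (+-identityʳ 0#)
    Σ-+ (x ∷ xs) f g = trans (+-congˡ (Σ-+ xs f g))
      (solve 4 (λ a b c d → (a :+ b) :+ (c :+ d) := (a :+ c) :+ (b :+ d)) refl (f x) (g x) (Σ[ xs ] f) (Σ[ xs ] g))

    Σ-sub : (xs : List A) (f g : A → Carrier) → Σ[ xs ] (λ x → f x - g x) ≈ Σ[ xs ] f - Σ[ xs ] g
    Σ-sub []       f g = sym (-‿inverseʳ 0#)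
    Σ-sub (x ∷ xs) f g = trans (+-congˡ (Σ-sub xs f g))
      (solve 4 (λ a b c d → (a :- b) :+ (c :- d) := (a :+ c) :- (b :+ d)) refl (f x) (g x) (Σ[ xs ] f) (Σ[ xs ] g))

    Σ-*ˡ : (xs : List A) (k : Carrier) (f : A → Carrier) → Σ[ xs ] (λ x → k * f x) ≈ k * Σ[ xs ] f
    Σ-*ˡ []       k f = sym (zeroʳ k)
    Σ-*ˡ (x ∷ xs) k f = trans (+-congˡ (Σ-*ˡ xs k f)) (sym (distribˡ k (f x) (Σ[ xs ] f)))

    Σ-*ʳ : (xs : List A) (k : Carrier) (f : A → Carrier) → Σ[ xs ] (λ x → f x * k) ≈ Σ[ xs ] f * k
    Σ-*ʳ []       k f = sym (zeroˡ k)
    Σ-*ʳ (x ∷ xs) k f = trans (+-congˡ (Σ-*ʳ xs k f)) (sym (distribʳ k (f x) (Σ[ xs ] f)))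

    Σ-++ : (xs ys : List A) (f : A → Carrier) → Σ[ xs ++ ys ] f ≈ Σ[ xs ] f + Σ[ ys ] f
    Σ-++ []       ys f = sym (+-identityˡ _)
    Σ-++ (x ∷ xs) ys f = trans (+-congˡ (Σ-++ xs ys f)) (sym (+-assoc _ _ _))

    Σ-filter : {P : A → Set} (P? : Decidable P) (xs : List A) (f : A → Carrier) →
               Σ[ filter P? xs ] f ≈ Σ[ xs ] (λ x → f x when P? x)
    Σ-filter P? []       f = refl
    Σ-filter P? (x ∷ xs) f with P? x
    ... | yes _ = +-congˡ (Σ-filter P? xs f)
    ... | no _  = trans (Σ-filter P? xs f) (sym (+-identityˡ _))

  module _ {A B : Set} where

    Σ-map : (h : A → B) (xs : List A) (f : B → Carrier) → Σ[ map h xs ] f ≈ Σ[ xs ] (λ x → f (h x))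
    Σ-map h xs f = reflexive (foldr-map _ h 0# xs)

    Σ-concatMap : (h : A → List B) (xs : List A) (f : B → Carrier) →
                  Σ[ concatMap h xs ] f ≈ Σ[ xs ] (λ x → Σ[ h x ] f)
    Σ-concatMap h []       f = refl
    Σ-concatMap h (x ∷ xs) f = trans (Σ-++ (h x) (concatMap h xs) f) (+-congˡ (Σ-concatMap h xs f))

    Σ-comm : (xs : List A) (ys : List B) (g : A → B → Carrier) →
             Σ[ xs ] (λ i → Σ[ ys ] (g i)) ≈ Σ[ ys ] (λ j → Σ[ xs ] (λ i → g i j))
    Σ-comm []       ys g = sym (Σ-0 ys)
    Σ-comm (x ∷ xs) ys g = trans (+-congˡ (Σ-comm xs ys g)) (sym (Σ-+ ys (g x) (λ j → Σ[ xs ] (λ i → g i j))))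

  when-<-+-when-> : ∀ {n} (i j : Fin n) x → x when (i <? j) + x when (j <? i) ≈ x when ¬? (i ≟ j)
  when-<-+-when-> i j x with <-cmp i j
  ... | tri< i<j i≢j j≮i
    rewrite dec-true (i <? j) i<j | dec-false (j <? i) j≮i | dec-true (¬? (i ≟ j)) i≢j = +-identityʳ x
  ... | tri≈ i≮j i≡j j≮i
    rewrite dec-false (i <? j) i≮j | dec-false (j <? i) j≮i | dec-false (¬? (i ≟ j)) (λ i≢j → i≢j i≡j)
    = +-identityʳ 0#
  ... | tri> i≮j i≢j j<i
    rewrite dec-false (i <? j) i≮j | dec-true (j <? i) j<i | dec-true (¬? (i ≟ j)) i≢j = +-identityˡ x

  Σ-neighboursK : ∀ n i (f : Fin n → Carrier) →
    Σ[ neighboursK n i ] f ≈ Σ[ allFin n ] (λ j → f j when ¬? (i ≟ j))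
  Σ-neighboursK n i = Σ-filter (λ j → ¬? (i ≟ j)) (allFin n)

  Σ-neighboursK-diagonal : ∀ n i (f : Fin n → Carrier) → f i ≈ 0# → Σ[ neighboursK n i ] f ≈ Σ[ allFin n ] f
  Σ-neighboursK-diagonal n i f fi≈0 = trans (Σ-neighboursK n i f) (Σ-cong (allFin n) off-diagonal)
    where
    off-diagonal : ∀ j → f j when ¬? (i ≟ j) ≈ f j
    off-diagonal j with i ≟ j
    ... | yes ≡.refl = sym fi≈0
    ... | no _       = refl

  Σ-completeGraph : ∀ n {F : Fin n × Fin n → Carrier} (g : Fin n → Fin n → Carrier) →
    (∀ i j → F (i , j) ≈ g i j + g j i) →
    Σ[ Graph.E (completeGraph n) ] F ≈ Σ[ allFin n ] (λ i → Σ[ neighboursK n i ] (g i))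
  Σ-completeGraph n {F} g F≈g+gᵀ = begin
    Σ[ Graph.E (completeGraph n) ] F
      ≈⟨ Σ-concatMap (λ i → map (i ,_) (filter (i <?_) all)) all F ⟩
    Σ[ all ] (λ i → Σ[ map (i ,_) (filter (i <?_) all) ] F)
      ≈⟨ Σ-cong all (λ i → trans (Σ-map (i ,_) (filter (i <?_) all) F) (Σ-filter (i <?_) all _)) ⟩
    Σ[ all ] (λ i → Σ[ all ] (λ j → F (i , j) when (i <? j)))
      ≈⟨ Σ-cong all (λ i → Σ-cong all (λ j →
           trans (when-cong (i <? j) (F≈g+gᵀ i j)) (when-+ (i <? j) _ _))) ⟩
    Σ[ all ] (λ i → Σ[ all ] (λ j → upper i j + g j i when (i <? j)))
      ≈⟨ Σ²-+ upper (λ i j → g j i when (i <? j)) ⟩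
    Σ[ all ] (λ i → Σ[ all ] (upper i)) + Σ[ all ] (λ i → Σ[ all ] (λ j → g j i when (i <? j)))
      ≈⟨ +-congˡ (Σ-comm all all (λ i j → g j i when (i <? j))) ⟩
    Σ[ all ] (λ i → Σ[ all ] (upper i)) + Σ[ all ] (λ i → Σ[ all ] (lower i))
      ≈⟨ Σ²-+ upper lower ⟨
    Σ[ all ] (λ i → Σ[ all ] (λ j → upper i j + lower i j))
      ≈⟨ Σ-cong all (λ i → Σ-cong all (λ j → when-<-+-when-> i j (g i j))) ⟩
    Σ[ all ] (λ i → Σ[ all ] (λ j → g i j when ¬? (i ≟ j)))
      ≈⟨ Σ-cong all (λ i → Σ-neighboursK n i (g i)) ⟨
    Σ[ all ] (λ i → Σ[ neighboursK n i ] (g i)) ∎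
    where
    all : List (Fin n)
    all = allFin n
    upper lower : Fin n → Fin n → Carrier
    upper i j = g i j when (i <? j)
    lower i j = g i j when (j <? i)
    Σ²-+ : (f h : Fin n → Fin n → Carrier) →
      Σ[ all ] (λ i → Σ[ all ] (λ j → f i j + h i j))
        ≈ Σ[ all ] (λ i → Σ[ all ] (f i)) + Σ[ all ] (λ i → Σ[ all ] (h i))
    Σ²-+ f h = trans (Σ-cong all (λ i → Σ-+ all (f i) (h i))) (Σ-+ all _ _)

module PlaneLemmas {c ℓ : Level} (R : RealField c ℓ) where
  open RealField R hiding (zero)
  open Plane R
  open IntegerCoefficientRingSolver commRing
  open SquareRoot R
  open ListSums R
  open import Relation.Binary.Reasoning.Setoid setoid

  ∣-∣-sym : ∀ p q → ∣ p -ᵥ q ∣ ≈ ∣ q -ᵥ p ∣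
  ∣-∣-sym (a , b) (a′ , b′) = sqrt-cong (+-nonneg (0≤x*x (a - a′)) (0≤x*x (b - b′)))
    (solve 4 (λ a b a′ b′ → (a :- a′) :* (a :- a′) :+ (b :- b′) :* (b :- b′)
                           := (a′ :- a) :* (a′ :- a) :+ (b′ :- b) :* (b′ :- b)) refl a b a′ b′)

  ⟨⟩-zeroˡ : ∀ {a} b → a ≈₂ (0# , 0#) → ⟨ a , b ⟩ ≈ 0#
  ⟨⟩-zeroˡ (b₁ , b₂) (a₁≈0 , a₂≈0) = begin
    _ * b₁ + _ * b₂   ≈⟨ +-cong (*-congʳ a₁≈0) (*-congʳ a₂≈0) ⟩
    0# * b₁ + 0# * b₂ ≈⟨ +-cong (zeroˡ b₁) (zeroˡ b₂) ⟩
    0# + 0#           ≈⟨ +-identityʳ 0# ⟩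
    0#                ∎

  module _ {n : ℕ} (xs : List (Fin n)) (f : Fin n → ℝ²) where

    Σ-⟨⟩ˡ : ∀ b → Σ[ xs ] (λ i → ⟨ f i , b ⟩) ≈ ⟨ Σᵥ xs f , b ⟩
    Σ-⟨⟩ˡ (b₁ , b₂) = trans (Σ-+ xs _ _) (+-cong (Σ-*ʳ xs b₁ _) (Σ-*ʳ xs b₂ _))

    Σ-⟨⟩ʳ : ∀ a → Σ[ xs ] (λ i → ⟨ a , f i ⟩) ≈ ⟨ a , Σᵥ xs f ⟩
    Σ-⟨⟩ʳ (a₁ , a₂) = trans (Σ-+ xs _ _) (+-cong (Σ-*ˡ xs a₁ _) (Σ-*ˡ xs a₂ _))

  ⟨⟩-expand : ∀ λi λj a b b′ → (λi * λj) * ⟨ a , b -ᵥ b′ ⟩ ≈ λj * (λi * ⟨ a , b ⟩) - ⟨ λi ·ᵥ a , λj ·ᵥ b′ ⟩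
  ⟨⟩-expand λi λj (a₁ , a₂) (b₁ , b₂) (b₁′ , b₂′) = solve 8 (λ λi λj a₁ a₂ b₁ b₂ b₁′ b₂′ →
      (λi :* λj) :* (a₁ :* (b₁ :- b₁′) :+ a₂ :* (b₂ :- b₂′))
    := λj :* (λi :* (a₁ :* b₁ :+ a₂ :* b₂)) :- ((λi :* a₁) :* (λj :* b₁′) :+ (λi :* a₂) :* (λj :* b₂′)))
    refl λi λj a₁ a₂ b₁ b₂ b₁′ b₂′

  ⟨⟩-x-x : ∀ a b → ⟨ a , b -ᵥ b ⟩ ≈ 0#
  ⟨⟩-x-x (a₁ , a₂) (b₁ , b₂) = begin
    a₁ * (b₁ - b₁) + a₂ * (b₂ - b₂) ≈⟨ +-cong (*-congˡ (-‿inverseʳ b₁)) (*-congˡ (-‿inverseʳ b₂)) ⟩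
    a₁ * 0# + a₂ * 0#               ≈⟨ +-cong (zeroʳ a₁) (zeroʳ a₂) ⟩
    0# + 0#                         ≈⟨ +-identityʳ 0# ⟩
    0#                              ∎

  module _ {n : ℕ} (xs : List (Fin n)) (λs : Fin n → Carrier) (p v : Fin n → ℝ²) where

    Σ²-λλ⟨p,v-v⟩ : Σ[ xs ] (λ i → Σ[ xs ] (λ j → (λs i * λs j) * ⟨ p i , v i -ᵥ v j ⟩))
      ≈ Σ[ xs ] λs * Σ[ xs ] (λ i → λs i * ⟨ p i , v i ⟩)
        - ⟨ Σᵥ xs (λ i → λs i ·ᵥ p i) , Σᵥ xs (λ j → λs j ·ᵥ v j) ⟩
    Σ²-λλ⟨p,v-v⟩ = begin
      Σ[ xs ] (λ i → Σ[ xs ] (λ j → (λs i * λs j) * ⟨ p i , v i -ᵥ v j ⟩))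
        ≈⟨ Σ-cong xs (λ i → Σ-cong xs (λ j → ⟨⟩-expand (λs i) (λs j) (p i) (v i) (v j))) ⟩
      Σ[ xs ] (λ i → Σ[ xs ] (λ j → λs j * λ⟨p,v⟩ i - ⟨ λp i , λv j ⟩))
        ≈⟨ Σ-cong xs (λ i → trans (Σ-sub xs _ _) (+-cong (Σ-*ʳ xs (λ⟨p,v⟩ i) λs) (-‿cong (Σ-⟨⟩ʳ xs λv (λp i))))) ⟩
      Σ[ xs ] (λ i → Σ[ xs ] λs * λ⟨p,v⟩ i - ⟨ λp i , V ⟩)
        ≈⟨ trans (Σ-sub xs _ _) (+-cong (Σ-*ˡ xs (Σ[ xs ] λs) λ⟨p,v⟩) (-‿cong (Σ-⟨⟩ˡ xs λp V))) ⟩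
      Σ[ xs ] λs * Σ[ xs ] λ⟨p,v⟩ - ⟨ Σᵥ xs λp , V ⟩ ∎
      where
      λ⟨p,v⟩ : Fin n → Carrier
      λ⟨p,v⟩ i = λs i * ⟨ p i , v i ⟩
      λp λv : Fin n → ℝ²
      λp i = λs i ·ᵥ p i
      λv j = λs j ·ᵥ v j
      V : ℝ²
      V = Σᵥ xs λv

module CompleteGraphStress {c ℓ : Level} (R : RealField c ℓ) where
  open RealField R hiding (zero)
  open Plane R
  open IntegerCoefficientRingSolver commRing
  open ListSums R
  open PlaneLemmas R
  open import Relation.Binary.Reasoning.Setoid setoid

  halfEdge : (λi λj : Carrier) (pi pj vi vj : ℝ²) (ti : Carrier) → Carrier
  halfEdge λi λj pi pj vi vj ti = (λi * λj) * (⟨ pi , vi -ᵥ vj ⟩ - ∣ pi -ᵥ pj ∣ * ti)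

  stress-edge-split : ∀ λi λj (pi pj vi vj : ℝ²) ti tj →
    (λi * λj) * (⟨ pi -ᵥ pj , vi -ᵥ vj ⟩ - ∣ pi -ᵥ pj ∣ * (ti + tj))
      ≈ halfEdge λi λj pi pj vi vj ti + halfEdge λj λi pj pi vj vi tj
  stress-edge-split λi λj pi@(xi , yi) pj@(xj , yj) (ui , zi) (uj , zj) ti tj = trans
    (solve 13 (λ λi λj xi yi xj yj ui zi uj zj D ti tj →
        (λi :* λj) :* (((xi :- xj) :* (ui :- uj) :+ (yi :- yj) :* (zi :- zj)) :- D :* (ti :+ tj))
      := (λi :* λj) :* ((xi :* (ui :- uj) :+ yi :* (zi :- zj)) :- D :* ti)
         :+ (λj :* λi) :* ((xj :* (uj :- ui) :+ yj :* (zj :- zi)) :- D :* tj))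
      refl λi λj xi yi xj yj ui zi uj zj ∣ pi -ᵥ pj ∣ ti tj)
    (+-congˡ (*-congˡ (+-congˡ (-‿cong (*-congʳ (∣-∣-sym pi pj))))))

  module _ (n : ℕ) (p : Fin n → ℝ²) (λs : Fin n → Carrier) (v : Fin n → ℝ²) (t : Fin n → Carrier) where

    stress-sum-reduction :
      Σ[ Graph.E (completeGraph n) ] (λ { (i , j) →
           (λs i * λs j) * (⟨ p i -ᵥ p j , v i -ᵥ v j ⟩ - (∣ p i -ᵥ p j ∣ * (t i + t j))) })
      + Σ[ allFin n ] (λ i → Σ[ neighboursK n i ] (λ j → (λs i * λs j) * ∣ p i -ᵥ p j ∣) * t i)
      ≈ Σ[ allFin n ] (λ i → Σ[ allFin n ] (λ j → (λs i * λs j) * ⟨ p i , v i -ᵥ v j ⟩))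
    stress-sum-reduction = begin
      Σ[ Graph.E (completeGraph n) ] _ + Σ[ all ] αt
        ≈⟨ +-congʳ (Σ-completeGraph n g (λ i j →
             stress-edge-split (λs i) (λs j) (p i) (p j) (v i) (v j) (t i) (t j))) ⟩
      Σ[ all ] (λ i → Σ[ nb i ] (g i)) + Σ[ all ] αt
        ≈⟨ +-congʳ (trans (Σ-cong all separate-t) (Σ-sub all _ αt)) ⟩
      (Σ[ all ] (λ i → Σ[ nb i ] (h i)) - Σ[ all ] αt) + Σ[ all ] αt
        ≈⟨ solve 2 (λ a b → (a :- b) :+ b := a) refl _ _ ⟩
      Σ[ all ] (λ i → Σ[ nb i ] (h i))
        ≈⟨ Σ-cong all (λ i → Σ-neighboursK-diagonal n i (h i) (h-diagonal i)) ⟩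
      Σ[ all ] (λ i → Σ[ all ] (h i)) ∎
      where
      all : List (Fin n)
      all = allFin n
      nb : Fin n → List (Fin n)
      nb = neighboursK n
      g h : Fin n → Fin n → Carrier
      g i j = halfEdge (λs i) (λs j) (p i) (p j) (v i) (v j) (t i)
      h i j = (λs i * λs j) * ⟨ p i , v i -ᵥ v j ⟩
      αt : Fin n → Carrier
      αt i = Σ[ nb i ] (λ j → (λs i * λs j) * ∣ p i -ᵥ p j ∣) * t i
      separate-t : ∀ i → Σ[ nb i ] (g i) ≈ Σ[ nb i ] (h i) - αt i
      separate-t i = trans
        (Σ-cong (nb i) (λ j → solve 4 (λ w a d t → w :* (a :- d :* t) := w :* a :- (w :* d) :* t) refl
                                  (λs i * λs j) ⟨ p i , v i -ᵥ v j ⟩ ∣ p i -ᵥ p j ∣ (t i)))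
        (trans (Σ-sub (nb i) _ _) (+-congˡ (-‿cong (Σ-*ʳ (nb i) (t i) _))))
      h-diagonal : ∀ i → h i i ≈ 0#
      h-diagonal i = trans (*-congˡ (⟨⟩-x-x (p i) (v i))) (zeroʳ _)

lemma4p2 : ∀ {c ℓ : Level} (R : RealField c ℓ) → let open RealField R in let open Plane R in
    (n : ℕ) (p : Fin n → ℝ²) (λs : Fin n → Carrier) →
    (Σᵥ (allFin n) (λ i → λs i ·ᵥ p i) ≈₂ (0# , 0#)) →
    (Σ[ allFin n ] λs) ≈ 0# →
    IsStress p (completeGraph n) (λ i j → λs i * λs j)
      (λ i → Σ[ neighboursK n i ] (λ j → (λs i * λs j) * ∣ p i -ᵥ p j ∣))
lemma4p2 R n p λs Σλp≈0 Σλ≈0 v t = begin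
  _ ≈⟨ stress-sum-reduction n p λs v t ⟩
  Σ[ all ] (λ i → Σ[ all ] (λ j → (λs i * λs j) * ⟨ p i , v i -ᵥ v j ⟩))
    ≈⟨ Σ²-λλ⟨p,v-v⟩ all λs p v ⟩
  Σ[ all ] λs * _ - ⟨ Σᵥ all (λ i → λs i ·ᵥ p i) , _ ⟩
    ≈⟨ +-cong (trans (*-congʳ Σλ≈0) (zeroˡ _)) (-‿cong (⟨⟩-zeroˡ _ Σλp≈0)) ⟩
  0# - 0#
    ≈⟨ -‿inverseʳ 0# ⟩
  0# ∎
  where
  open RealField R hiding (zero)
  open Plane R
  open PlaneLemmas R
  open CompleteGraphStress R
  open import Relation.Binary.Reasoning.Setoid setoid
  all : List (Fin n)
  all = allFin n
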